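{- The set $\mathcal R_Q=\{p\in\mathcal P^{\circ\bullet}\mid Z(\{p\})\leq Q\}$ is a category of two-colored partitions (a) if $Q=(\{1,2\},\pm\{0,1,2\},\mathbb Z,\mathbb Z,\mathbb Z,\mathbb Z)$, (b) if $Q=(\{2\},\pm\{0,2\},2\mathbb Z,\mathbb Z,\mathbb Z,\mathbb Z)$, (c) if $Q=(\{2\},\{0\},\{0\},\emptyset,\mathbb Z,\mathbb Z)$, or (d) if $Q=(\{1,2\},\pm\{0,1\},\mathbb Z,\emptyset,\mathbb Z,\mathbb Z)$.
   Context: A two-colored partition $p$ consists of a lower row $R_L$ and an upper row $R_U$ (disjoint, possibly empty, finite totally ordered sets), a decomposition of $P_p=R_L\cup R_U$ into disjoint nonempty blocks, and a coloring of each point by $\circ$ or $\bullet$; $\mathcal P^{\circ\bullet}$ is the set of all such. Orientation: the cyclic order on $P_p$ agreeing with the order of $R_L$ on $R_L$, with the reverse order of $R_U$ on $R_U$, with the maximum of $R_U$ succeeding the maximum of $R_L$ and the minimum of $R_L$ succeeding the minimum of $R_U$; intervals $]\alpha,\beta[_p$, $]\alpha,\beta]_p$ for distinct $\alpha,\beta$ refer to this cyclic order. Normalized color: color for lower points, inverse color for upper points. $\sigma_p(S)$: number of normalized-white minus number of normalized-black points of $S$; $\Sigma(p)=\sigma_p(P_p)$. Color distance: $\delta_p(\alpha,\alpha)=\Sigma(p)$; for $\alpha\ne\beta$, $\delta_p(\alpha,\beta)=\sigma_p(]\alpha,\beta[_p)$ if their normalized colors differ and $\sigma_p(]\alpha,\beta]_p)$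 if they agree. Blocks $B\neq B'$ cross if there are pairwise distinct $\alpha,\beta\in B$, $\alpha',\beta'\in B'$ appearing in the cyclic order in the order $\alpha,\alpha',\beta,\beta'$. For a set $\mathcal S$ of partitions: $F(\mathcal S)=\{|B|: p\in\mathcal S, B$ block of $p\}$; $V(\mathcal S)=\{\sigma_p(B): p\in\mathcal S,B$ block of $p\}$; $\Sigma(\mathcal S)=\{\Sigma(p):p\in\mathcal S\}$; $L(\mathcal S)$ (resp. $K(\mathcal S)$) is the set of $\delta_p(\alpha_1,\alpha_2)$ over $p\in\mathcal S$, blocks $B$ of $p$, $\alpha_1\neq\alpha_2\in B$ with $]\alpha_1,\alpha_2[_p\cap B=\emptyset$ and $\sigma_p(\{\alpha_1,\alpha_2\})\neq0$ (resp. $=0$); $X(\mathcal S)$ is the set of $\delta_p(\alpha_1,\alpha_2)$ over $p\in\mathcal S$, crossing blocks $B_1,B_2$ of $p$, $\alpha_1\in B_1,\alpha_2\in B_2$. $Z=(F,V,\Sigma,L,K,X)$ and $\leq$ is componentwise inclusion of 6-tuples of subsets of $\mathbb Z$. $\pm S=S\cup(-S)$. Category: A set $\mathcal C\subseteq\mathcal P^{\circ\bullet}$ is a category if it contains the empty partition, the two partitions with one lower and one upper point of the same color ($\circ$ or $\bullet$) forming one block, and the two partitions without upper points having two lower points colored $\bullet\circ$ resp. $\circ\bullet$ forming one block, and is closed under: tensor product (append the rows of the second partition to the right of those of the first); involution (exchange upper and lower rows); and composition $pp'$ of pairs $(p,p')$ where the upper row of $p$ and lower row of $p'$ have equal length and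 equal colors rank by rank, defined by taking the lower row of $p$ and the upper row of $p'$ as rows, identifying the upper row of $p$ with the lower row of $p'$, and letting the blocks be the nonempty intersections with the new point set of the classes of the equivalence relation generated by the blocks of $p$ and of $p'$. -}

module Defs where

open import Data.Bool using (Bool; true; false; if_then_else_; _∧_; _∨_)
open import Data.Nat using (ℕ; zero; suc; _∸_; _≤ᵇ_; _<ᵇ_; _≡ᵇ_) renaming (_+_ to _+ℕ_; _≤_ to _≤ℕ_)
open import Data.Integer using (ℤ; +_; -[1+_]; _+_; ∣_∣)
open import Data.Integer.Divisibility using (_∣_)
open import Data.Fin using (Fin; toℕ; cast; splitAt; zero; suc)
open import Data.List using (List; []; _∷_; _++_; map; foldr; allFin)
open import Data.Sum using (_⊎_; inj₁; inj₂)
open import Data.Product using (_×_; _,_; Σ; ∃)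
open import Data.Unit using (⊤)
open import Data.Empty using (⊥)
open import Relation.Binary.PropositionalEquality using (_≡_; _≢_; refl)
open import Relation.Binary.Construct.Closure.Equivalence using (EqClosure)
open import Function.Bundles using (_⇔_)

data Color : Set where
  ○ ● : Color

inv : Color → Color
inv ○ = ●
inv ● = ○

-- points: lower row Fin k (inj₁), upper row Fin l (inj₂)
Pt : ℕ → ℕ → Set
Pt k l = Fin k ⊎ Fin l

-- A partition: row lengths, colors of the points, and the block relation
-- ("same x y ≡ true" iff x and y lie in the same block), an equivalence.
record Part : Set where
  constructor mkPart
  field
    k l   : ℕ
    lc    : Fin k → Color
    uc    : Fin l → Color
    same  : Pt k l → Pt k l → Bool
    same-refl  : ∀ x → same x x ≡ true
    same-sym   : ∀ x y → same x y ≡ true → same y x ≡ true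
    same-trans : ∀ x y z → same x y ≡ true → same y z ≡ true → same x z ≡ true

open Part public

PtOf : Part → Set
PtOf p = Pt (k p) (l p)

allPts : (k l : ℕ) → List (Pt k l)
allPts k l = map inj₁ (allFin k) ++ map inj₂ (allFin l)

ncol : (p : Part) → PtOf p → Color
ncol p (inj₁ i) = lc p i
ncol p (inj₂ j) = inv (uc p j)

wt : Color → ℤ
wt ○ = + 1
wt ● = -[1+ 0 ]

sameCol : Color → Color → Bool
sameCol ○ ○ = true
sameCol ● ● = true
sameCol _ _ = false

σ : (p : Part) → (PtOf p → Bool) → ℤ
σ p S = foldr (λ x acc → (if S x then wt (ncol p x) else + 0) + acc) (+ 0) (allPts (k p) (l p))

Σp : Part → ℤ
Σp p = σ p (λ _ → true)

card : (p : Part) → (PtOf p → Bool) → ℕ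
card p S = foldr (λ x acc → (if S x then 1 else 0) +ℕ acc) 0 (allPts (k p) (l p))

-- position in the cyclic order: lower row 0..k-1 in order, then the upper
-- row in reverse order (maximum of R_U right after maximum of R_L)
pos : {k l : ℕ} → Pt k l → ℕ
pos {k} {l} (inj₁ i) = toℕ i
pos {k} {l} (inj₂ j) = k +ℕ (l ∸ suc (toℕ j))

dist : {k l : ℕ} → Pt k l → Pt k l → ℕ
dist {k} {l} α γ = if pos α ≤ᵇ pos γ then pos γ ∸ pos α else (k +ℕ l +ℕ pos γ) ∸ pos α

eqPt : {k l : ℕ} → Pt k l → Pt k l → Bool
eqPt α β = pos α ≡ᵇ pos β

-- γ ∈ ]α,β[ and γ ∈ ]α,β]
inOpen : {k l : ℕ} → Pt k l → Pt k l → Pt k l → Bool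
inOpen α β γ = (0 <ᵇ dist α γ) ∧ (dist α γ <ᵇ dist α β)

inHalf : {k l : ℕ} → Pt k l → Pt k l → Pt k l → Bool
inHalf α β γ = (0 <ᵇ dist α γ) ∧ (dist α γ ≤ᵇ dist α β)

δ : (p : Part) → PtOf p → PtOf p → ℤ
δ p α β =
  if eqPt α β then Σp p
  else (if sameCol (ncol p α) (ncol p β) then σ p (inHalf α β) else σ p (inOpen α β))

Crossing : (p : Part) → PtOf p → PtOf p → Set
Crossing p a1 a2 =
  same p a1 a2 ≡ false ×
  Σ (PtOf p) λ α → Σ (PtOf p) λ β → Σ (PtOf p) λ α' → Σ (PtOf p) λ β' →
    same p a1 α ≡ true × same p a1 β ≡ true ×
    same p a2 α' ≡ true × same p a2 β' ≡ true ×
    (0 <ᵇ dist α α') ≡ true × (dist α α' <ᵇ dist α β) ≡ true × (dist α β <ᵇ dist α β') ≡ true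

record Sixtuple : Set₁ where
  field
    QF : ℕ → Set
    QV QΣ QL QK QX : ℤ → Set

open Sixtuple public

record ZLe (p : Part) (Q : Sixtuple) : Set where
  field
    zF : ∀ a → QF Q (card p (same p a))
    zV : ∀ a → QV Q (σ p (same p a))
    zΣ : QΣ Q (Σp p)
    zL : ∀ a1 a2 → a1 ≢ a2 → same p a1 a2 ≡ true →
         (∀ γ → inOpen a1 a2 γ ≡ true → same p a1 γ ≢ true) →
         σ p (λ γ → eqPt γ a1 ∨ eqPt γ a2) ≢ + 0 → QL Q (δ p a1 a2)
    zK : ∀ a1 a2 → a1 ≢ a2 → same p a1 a2 ≡ true →
         (∀ γ → inOpen a1 a2 γ ≡ true → same p a1 γ ≢ true) →
         σ p (λ γ → eqPt γ a1 ∨ eqPt γ a2) ≡ + 0 → QK Q (δ p a1 a2)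
    zX : ∀ a1 a2 → Crossing p a1 a2 → QX Q (δ p a1 a2)

R : Sixtuple → Part → Set
R Q p = ZLe p Q

emptyP : Part
emptyP = mkPart 0 0 (λ ()) (λ ()) (λ { (inj₁ ()) ; (inj₂ ()) }) (λ { (inj₁ ()) ; (inj₂ ()) })
                (λ { (inj₁ ()) ; (inj₂ ()) }) (λ { (inj₁ ()) ; (inj₂ ()) })

idP : Color → Part
idP c = mkPart 1 1 (λ _ → c) (λ _ → c) (λ _ _ → true) (λ _ → refl) (λ _ _ _ → refl) (λ _ _ _ _ _ → refl)

pairP : Color → Color → Part
pairP c₀ c₁ = mkPart 2 0 col (λ ()) (λ _ _ → true) (λ _ → refl) (λ _ _ _ → refl) (λ _ _ _ _ _ → refl)
  where
  col : Fin 2 → Color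
  col zero = c₀
  col (suc _) = c₁

sameSum : (p q : Part) → PtOf p ⊎ PtOf q → PtOf p ⊎ PtOf q → Bool
sameSum p q (inj₁ a) (inj₁ b) = same p a b
sameSum p q (inj₂ a) (inj₂ b) = same q a b
sameSum p q _ _ = false

sameSum-refl : (p q : Part) → ∀ x → sameSum p q x x ≡ true
sameSum-refl p q (inj₁ a) = same-refl p a
sameSum-refl p q (inj₂ a) = same-refl q a

sameSum-sym : (p q : Part) → ∀ x y → sameSum p q x y ≡ true → sameSum p q y x ≡ true
sameSum-sym p q (inj₁ a) (inj₁ b) e = same-sym p a b e
sameSum-sym p q (inj₂ a) (inj₂ b) e = same-sym q a b e
sameSum-sym p q (inj₁ a) (inj₂ b) ()
sameSum-sym p q (inj₂ a) (inj₁ b) ()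

sameSum-trans : (p q : Part) → ∀ x y z → sameSum p q x y ≡ true → sameSum p q y z ≡ true → sameSum p q x z ≡ true
sameSum-trans p q (inj₁ a) (inj₁ b) (inj₁ c) e f = same-trans p a b c e f
sameSum-trans p q (inj₂ a) (inj₂ b) (inj₂ c) e f = same-trans q a b c e f
sameSum-trans p q (inj₁ a) (inj₁ b) (inj₂ c) e ()
sameSum-trans p q (inj₁ a) (inj₂ b) z () f
sameSum-trans p q (inj₂ a) (inj₁ b) z () f
sameSum-trans p q (inj₂ a) (inj₂ b) (inj₁ c) e ()

splitPt : (p q : Part) → Pt (k p +ℕ k q) (l p +ℕ l q) → PtOf p ⊎ PtOf q
splitPt p q (inj₁ i) with splitAt (k p) i
... | inj₁ a = inj₁ (inj₁ a)
... | inj₂ b = inj₂ (inj₁ b)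
splitPt p q (inj₂ j) with splitAt (l p) j
... | inj₁ a = inj₁ (inj₂ a)
... | inj₂ b = inj₂ (inj₂ b)

joinCol : {m n : ℕ} → (Fin m → Color) → (Fin n → Color) → Fin (m +ℕ n) → Color
joinCol {m} f g i with splitAt m i
... | inj₁ a = f a
... | inj₂ b = g b

-- tensor product: rows of q appended to the right of those of p
_⊗_ : Part → Part → Part
p ⊗ q = mkPart (k p +ℕ k q) (l p +ℕ l q) (joinCol (lc p) (lc q)) (joinCol (uc p) (uc q))
  (λ x y → sameSum p q (splitPt p q x) (splitPt p q y))
  (λ x → sameSum-refl p q (splitPt p q x))
  (λ x y → sameSum-sym p q (splitPt p q x) (splitPt p q y))
  (λ x y z → sameSum-trans p q (splitPt p q x) (splitPt p q y) (splitPt p q z))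

swapPt : {k l : ℕ} → Pt k l → Pt l k
swapPt (inj₁ i) = inj₂ i
swapPt (inj₂ j) = inj₁ j

_* : Part → Part
p * = mkPart (l p) (k p) (uc p) (lc p)
  (λ x y → same p (swapPt x) (swapPt y))
  (λ x → same-refl p (swapPt x))
  (λ x y → same-sym p (swapPt x) (swapPt y))
  (λ x y z → same-trans p (swapPt x) (swapPt y) (swapPt z))

-- Composition: p' on top of p, given l p ≡ k p' and matching colors.
-- Glued point set: PtOf p ⊎ PtOf p'; generating relation: blocks of p,
-- blocks of p', and identification of upper point j of p with lower
-- point j of p'.

data Gen (p p' : Part) (e : l p ≡ k p') : PtOf p ⊎ PtOf p' → PtOf p ⊎ PtOf p' → Set where
  genL  : ∀ a b → same p a b ≡ true → Gen p p' e (inj₁ a) (inj₁ b)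
  genU  : ∀ a b → same p' a b ≡ true → Gen p p' e (inj₂ a) (inj₂ b)
  genId : ∀ j → Gen p p' e (inj₁ (inj₂ j)) (inj₂ (inj₁ (cast e j)))

embed : (p p' : Part) → Pt (k p) (l p') → PtOf p ⊎ PtOf p'
embed p p' (inj₁ i) = inj₁ (inj₁ i)
embed p p' (inj₂ j) = inj₂ (inj₂ j)

IsCompRel : (p p' : Part) (e : l p ≡ k p') → (Pt (k p) (l p') → Pt (k p) (l p') → Bool) → Set
IsCompRel p p' e s = ∀ x y → (s x y ≡ true) ⇔ EqClosure (Gen p p' e) (embed p p' x) (embed p p' y)

record IsCategory (C : Part → Set) : Set₁ where
  field
    hasEmpty : C emptyP
    hasId○   : C (idP ○)
    hasId●   : C (idP ●)
    hasPair●○ : C (pairP ● ○)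
    hasPair○● : C (pairP ○ ●)
    closed⊗  : ∀ p q → C p → C q → C (p ⊗ q)
    closed*  : ∀ p → C p → C (p *)
    closedComp : ∀ p p' (e : l p ≡ k p') → (∀ j → uc p j ≡ lc p' (cast e j)) →
      (s : Pt (k p) (l p') → Pt (k p) (l p') → Bool) →
      (sr : ∀ x → s x x ≡ true) →
      (ss : ∀ x y → s x y ≡ true → s y x ≡ true) →
      (st : ∀ x y z → s x y ≡ true → s y z ≡ true → s x z ≡ true) →
      IsCompRel p p' e s →
      C p → C p' → C (mkPart (k p) (l p') (lc p) (uc p') s sr ss st)

Qa : Sixtuple
Qa = record
  { QF = λ n → n ≡ 1 ⊎ n ≡ 2
  ; QV = λ x → ∣ x ∣ ≡ 0 ⊎ ∣ x ∣ ≡ 1 ⊎ ∣ x ∣ ≡ 2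
  ; QΣ = λ _ → ⊤ ; QL = λ _ → ⊤ ; QK = λ _ → ⊤ ; QX = λ _ → ⊤ }

Qb : Sixtuple
Qb = record
  { QF = λ n → n ≡ 2
  ; QV = λ x → ∣ x ∣ ≡ 0 ⊎ ∣ x ∣ ≡ 2
  ; QΣ = λ x → + 2 ∣ x
  ; QL = λ _ → ⊤ ; QK = λ _ → ⊤ ; QX = λ _ → ⊤ }

Qc : Sixtuple
Qc = record
  { QF = λ n → n ≡ 2
  ; QV = λ x → x ≡ + 0
  ; QΣ = λ x → x ≡ + 0
  ; QL = λ _ → ⊥ ; QK = λ _ → ⊤ ; QX = λ _ → ⊤ }

Qd : Sixtuple
Qd = record
  { QF = λ n → n ≡ 1 ⊎ n ≡ 2
  ; QV = λ x → ∣ x ∣ ≡ 0 ⊎ ∣ x ∣ ≡ 1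
  ; QΣ = λ _ → ⊤ ; QL = λ _ → ⊥ ; QK = λ _ → ⊤ ; QX = λ _ → ⊤ }

-- Every Q has F ⊆ {1,2}, so membership in R_Q says that the block relation is given by an
-- involution (blocks are singletons or pairs), plus: nothing else in (a); no singletons and even
-- Σ in (b); no singletons, pairs of opposite normalized colours and Σ = 0 in (c); pairs of
-- opposite normalized colours in (d).  The L-condition of (c) and (d) holds because such a pair
-- has σ = 0, and K and X are unrestricted.  Each of these properties survives the category
-- operations.  Tensor product and involution only relabel points, and Σ is additive under ⊗ and
-- composition (the glued rows cancel) and changes sign under *.  For a composition, glue the
-- points of p and p′ and consider two involutions: π, the partner map of p and p′, and ι, which
-- swaps the two copies of each middle point and fixes exactly the outer points.  The block of an
-- outer point x is its orbit; the walk from x by π, ι, π, … never revisits a point until it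
-- stops, so by finiteness it ends either at a fixed point of π (then x is a singleton, and p or
-- p′ has one) or, after an odd number of steps, at a second outer point y.  When the pairs of p
-- and p′ are opposite, every step reverses the normalized colour, hence so does the walk.

module Submission where

open import Defs
open import Data.Product using (_×_)
open import Data.Product using (∃; _,_; proj₁; proj₂)
open import Data.Bool using (Bool; true; false; if_then_else_; _∨_; not)
open import Data.Nat using (ℕ; zero; suc; _<_; _≤_; z≤n; z<s; s<s) renaming (_+_ to _+ℕ_)
open import Data.Integer using (ℤ; +_; _+_; -_; ∣_∣)
import Data.Integer.Properties as ℤ
open import Algebra.Properties.Monoid.Sum ℤ.+-0-monoid using (sum; sum-cong-≗)
open import Algebra.Properties.CommutativeSemigroup ℤ.+-commutativeSemigroup using (interchange)
import Data.Nat.Properties as ℕ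
import Data.Bool.Properties as Bool
open import Data.Fin using (Fin; toℕ; cast; splitAt; join; _↑ˡ_; _↑ʳ_)
import Data.Fin.Properties as Fin
open import Data.List using (List; []; _∷_; _++_; map; foldr; allFin; tabulate; length; filterᵇ)
open import Data.List.Membership.Propositional using (_∈_)
open import Data.List.Membership.Propositional.Properties using (∈-allFin; ∈-map⁺; ∈-map⁻; ∈-++⁺ˡ; ∈-++⁺ʳ; ∈-filter⁺; ∈-filter⁻)
open import Data.List.Relation.Unary.Any using (here; there)
import Data.List.Relation.Unary.All as All
open import Data.List.Relation.Unary.AllPairs using ([]; _∷_)
open import Data.List.Relation.Unary.Unique.Propositional using (Unique)
import Data.List.Relation.Unary.Unique.Propositional.Properties as Unique
open import Data.Sum using (_⊎_; inj₁; inj₂; [_,_]′) renaming (map to map⊎; map₂ to map⊎₂)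
import Data.Sum.Properties as Sum
open import Data.Empty using (⊥; ⊥-elim)
open import Relation.Nullary using (¬_; yes; no)
open import Data.Unit using (⊤; tt)
open import Data.Integer.Divisibility using (_∣_; divides)
import Data.Integer.Divisibility.Signed as Signed
open import Relation.Binary.Definitions using (DecidableEquality; tri<; tri≈; tri>)
open import Relation.Binary.PropositionalEquality
open import Relation.Binary.Construct.Closure.ReflexiveTransitive using (Star; ε; _◅_; _◅◅_)
open import Relation.Binary.Construct.Closure.Symmetric using (SymClosure; fwd; bwd)
open import Function using (_∘_; id)
open import Function.Bundles using (_⇔_; mk⇔; Equivalence)

inv-involutive : ∀ c → inv (inv c) ≡ c
inv-involutive ○ = refl
inv-involutive ● = refl

wt-inv : ∀ c → wt (inv c) ≡ - wt c
wt-inv ○ = refl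
wt-inv ● = refl

∣wt∣≡1 : ∀ c → ∣ wt c ∣ ≡ 1
∣wt∣≡1 ○ = refl
∣wt∣≡1 ● = refl

∣wt+wt∣≡0∨2 : ∀ c d → ∣ wt c + wt d ∣ ≡ 0 ⊎ ∣ wt c + wt d ∣ ≡ 2
∣wt+wt∣≡0∨2 ○ ○ = inj₂ refl
∣wt+wt∣≡0∨2 ○ ● = inj₁ refl
∣wt+wt∣≡0∨2 ● ○ = inj₁ refl
∣wt+wt∣≡0∨2 ● ● = inj₂ refl

wt+wt≡0⇒inv : ∀ c d → wt c + wt d ≡ + 0 → d ≡ inv c
wt+wt≡0⇒inv ○ ● _ = refl
wt+wt≡0⇒inv ● ○ _ = refl

wt+wt-inv≡0 : ∀ c → wt c + wt (inv c) ≡ + 0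
wt+wt-inv≡0 ○ = refl
wt+wt-inv≡0 ● = refl

module _ {A : Set} where

  sumBy : (A → ℤ) → List A → ℤ
  sumBy f = foldr (λ x acc → f x + acc) (+ 0)

  count-filterᵇ : ∀ (S : A → Bool) xs →
    foldr (λ x n → (if S x then 1 else 0) +ℕ n) 0 xs ≡ length (filterᵇ S xs)
  count-filterᵇ S [] = refl
  count-filterᵇ S (x ∷ xs) with S x
  ... | true  = cong suc (count-filterᵇ S xs)
  ... | false = count-filterᵇ S xs

  sum-filterᵇ : ∀ (S : A → Bool) f xs →
    foldr (λ x acc → (if S x then f x else + 0) + acc) (+ 0) xs ≡ sumBy f (filterᵇ S xs)
  sum-filterᵇ S f [] = refl
  sum-filterᵇ S f (x ∷ xs) with S x
  ... | true  = cong (λ s → f x + s) (sum-filterᵇ S f xs)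
  ... | false = trans (ℤ.+-identityˡ _) (sum-filterᵇ S f xs)

  unique-listing-singleton : ∀ {ys} {a : A} → Unique ys → a ∈ ys →
    (∀ {y} → y ∈ ys → y ≡ a) → ys ≡ a ∷ []
  unique-listing-singleton {y ∷ []} _ _ only = cong (_∷ []) (only (here refl))
  unique-listing-singleton {y ∷ z ∷ _} ((y≢z All.∷ _) ∷ _) _ only =
    ⊥-elim (y≢z (trans (only (here refl)) (sym (only (there (here refl))))))

  unique-listing-pair : ∀ {ys} {a b : A} → Unique ys → a ∈ ys → b ∈ ys → a ≢ b →
    (∀ {y} → y ∈ ys → y ≡ a ⊎ y ≡ b) → ys ≡ a ∷ b ∷ [] ⊎ ys ≡ b ∷ a ∷ []
  unique-listing-pair {y ∷ []} _ (here refl) (here refl) a≢b _ = ⊥-elim (a≢b refl)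
  unique-listing-pair {y ∷ z ∷ []} ((y≢z All.∷ _) ∷ _) _ _ a≢b only
    with only (here refl) | only (there (here refl))
  ... | inj₁ refl | inj₂ refl = inj₁ refl
  ... | inj₂ refl | inj₁ refl = inj₂ refl
  ... | inj₁ refl | inj₁ refl = ⊥-elim (y≢z refl)
  ... | inj₂ refl | inj₂ refl = ⊥-elim (y≢z refl)
  unique-listing-pair {y ∷ z ∷ w ∷ _} ((y≢z All.∷ y≢w All.∷ _) ∷ (z≢w All.∷ _) ∷ _) _ _ _ only
    with only (here refl) | only (there (here refl)) | only (there (there (here refl)))
  ... | inj₁ refl | inj₁ refl | _ = ⊥-elim (y≢z refl)
  ... | inj₂ refl | inj₂ refl | _ = ⊥-elim (y≢z refl)
  ... | inj₁ refl | inj₂ refl | inj₁ refl = ⊥-elim (y≢w refl)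
  ... | inj₁ refl | inj₂ refl | inj₂ refl = ⊥-elim (z≢w refl)
  ... | inj₂ refl | inj₁ refl | inj₁ refl = ⊥-elim (z≢w refl)
  ... | inj₂ refl | inj₁ refl | inj₂ refl = ⊥-elim (y≢w refl)

  length≡1⇒≡ : ∀ {ys} {x y : A} → length ys ≡ 1 → x ∈ ys → y ∈ ys → x ≡ y
  length≡1⇒≡ {_ ∷ []} _ (here refl) (here refl) = refl

  length≡2⇒other : ∀ {ys} {a : A} → length ys ≡ 2 → Unique ys → a ∈ ys →
    ∃ λ b → b ≢ a × b ∈ ys × (∀ {y} → y ∈ ys → y ≡ a ⊎ y ≡ b)
  length≡2⇒other {y ∷ z ∷ []} _ ((y≢z All.∷ _) ∷ _) (here refl) =
    z , (λ z≡y → y≢z (sym z≡y)) , there (here refl) ,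
    λ { (here refl) → inj₁ refl ; (there (here refl)) → inj₂ refl }
  length≡2⇒other {y ∷ z ∷ []} _ ((y≢z All.∷ _) ∷ _) (there (here refl)) =
    y , y≢z , here refl ,
    λ { (here refl) → inj₂ refl ; (there (here refl)) → inj₁ refl }

  sumBy-pair : ∀ {ys} {a b : A} (f : A → ℤ) → ys ≡ a ∷ b ∷ [] ⊎ ys ≡ b ∷ a ∷ [] →
    length ys ≡ 2 × sumBy f ys ≡ f a + f b
  sumBy-pair {a = a} {b} f (inj₁ refl) = refl , cong (λ s → f a + s) (ℤ.+-identityʳ (f b))
  sumBy-pair {a = a} {b} f (inj₂ refl) =
    refl , trans (cong (λ s → f b + s) (ℤ.+-identityʳ (f a))) (ℤ.+-comm (f b) (f a))

pos-injective : ∀ {k l} (a b : Pt k l) → pos a ≡ pos b → a ≡ b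
pos-injective (inj₁ i) (inj₁ j) e = cong inj₁ (Fin.toℕ-injective e)
pos-injective {k} (inj₁ i) (inj₂ j) e = ⊥-elim (ℕ.<⇒≢ (ℕ.<-≤-trans (Fin.toℕ<n i) (ℕ.m≤m+n k _)) e)
pos-injective {k} (inj₂ j) (inj₁ i) e = ⊥-elim (ℕ.<⇒≢ (ℕ.<-≤-trans (Fin.toℕ<n i) (ℕ.m≤m+n k _)) (sym e))
pos-injective {k} (inj₂ i) (inj₂ j) e =
  cong inj₂ (Fin.toℕ-injective (ℕ.suc-injective
    (ℕ.∸-cancelˡ-≡ (Fin.toℕ<n i) (Fin.toℕ<n j) (ℕ.+-cancelˡ-≡ k _ _ e))))

eqPt⇒≡ : ∀ {k l} (a b : Pt k l) → eqPt a b ≡ true → a ≡ b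
eqPt⇒≡ a b e = pos-injective a b (ℕ.≡ᵇ⇒≡ (pos a) (pos b) (Bool.T-≡ .Equivalence.from e))

eqPt-refl : ∀ {k l} (a : Pt k l) → eqPt a a ≡ true
eqPt-refl a = Bool.T-≡ .Equivalence.to (ℕ.≡⇒≡ᵇ (pos a) (pos a) refl)

module _ {k l : ℕ} where

  ∈-allPts : (x : Pt k l) → x ∈ allPts k l
  ∈-allPts (inj₁ i) = ∈-++⁺ˡ (∈-map⁺ inj₁ (∈-allFin i))
  ∈-allPts (inj₂ j) = ∈-++⁺ʳ (map inj₁ (allFin k)) (∈-map⁺ inj₂ (∈-allFin j))

  allPts-unique : Unique (allPts k l)
  allPts-unique = Unique.++⁺ (Unique.map⁺ Sum.inj₁-injective (Unique.allFin⁺ k))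
                             (Unique.map⁺ Sum.inj₂-injective (Unique.allFin⁺ l)) disjoint
    where
    disjoint : ∀ {x} → ¬ (x ∈ map inj₁ (allFin k) × x ∈ map inj₂ (allFin l))
    disjoint (x∈₁ , x∈₂) with ∈-map⁻ inj₁ x∈₁ | ∈-map⁻ inj₂ x∈₂
    ... | _ , _ , refl | _ , _ , ()

  select : (Pt k l → Bool) → List (Pt k l)
  select S = filterᵇ S (allPts k l)

  select-unique : ∀ S → Unique (select S)
  select-unique S = Unique.filter⁺ (Bool.T? ∘ S) allPts-unique

  ∈-select⁺ : ∀ {S x} → S x ≡ true → x ∈ select S
  ∈-select⁺ {S} {x} Sx = ∈-filter⁺ (Bool.T? ∘ S) (∈-allPts x) (Bool.T-≡ .Equivalence.from Sx)

  ∈-select⁻ : ∀ {S x} → x ∈ select S → S x ≡ true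
  ∈-select⁻ {S} x∈ = Bool.T-≡ .Equivalence.to (proj₂ (∈-filter⁻ (Bool.T? ∘ S) {xs = allPts k l} x∈))

card≡length-select : ∀ p S → card p S ≡ length (select S)
card≡length-select p S = count-filterᵇ S (allPts (k p) (l p))

σ≡sumBy-select : ∀ p S → σ p S ≡ sumBy (λ x → wt (ncol p x)) (select S)
σ≡sumBy-select p S = sum-filterᵇ S (λ x → wt (ncol p x)) (allPts (k p) (l p))

_≟ₚ_ : ∀ {k l} → DecidableEquality (Pt k l)
_≟ₚ_ = Sum.≡-dec Fin._≟_ Fin._≟_

record Pairing {X : Set} (S : X → X → Bool) : Set where
  field
    partner : X → X
    related-partner : ∀ a → S a (partner a) ≡ true
    related⇒partner : ∀ a y → S a y ≡ true → y ≡ a ⊎ y ≡ partner a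

NoSingletons : {X : Set} → (X → X → Bool) → Set
NoSingletons S = ∀ a → ∃ λ b → b ≢ a × S a b ≡ true

OppositePairs : {X : Set} → (X → X → Bool) → (X → Color) → Set
OppositePairs S c = ∀ a b → b ≢ a → S a b ≡ true → c b ≡ inv (c a)

module _ {X : Set} {S : X → X → Bool} (P : Pairing S) where
  open Pairing P

  partner-moves : NoSingletons S → ∀ a → partner a ≢ a
  partner-moves noSingletons a πa≡a with noSingletons a
  ... | b , b≢a , Sab with related⇒partner a b Sab
  ...   | inj₁ b≡a  = b≢a b≡a
  ...   | inj₂ b≡πa = b≢a (trans b≡πa πa≡a)

  partner-involutive : (∀ a b → S a b ≡ true → S b a ≡ true) → ∀ a → partner (partner a) ≡ a
  partner-involutive S-sym a with related⇒partner (partner a) a (S-sym a (partner a) (related-partner a))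
  ... | inj₁ a≡πa = trans (cong partner (sym a≡πa)) (sym a≡πa)
  ... | inj₂ a≡ππa = sym a≡ππa

  oppositePairs-by-partner : ∀ {c} → (∀ a → partner a ≢ a → c (partner a) ≡ inv (c a)) →
    OppositePairs S c
  oppositePairs-by-partner opp a b b≢a Sab with related⇒partner a b Sab
  ... | inj₁ b≡a  = ⊥-elim (b≢a b≡a)
  ... | inj₂ refl = opp a b≢a

weight : (p : Part) → PtOf p → ℤ
weight p x = wt (ncol p x)

module _ (p : Part) where

  card≡1⇒singleton : ∀ a → card p (same p a) ≡ 1 → ∀ y → same p a y ≡ true → y ≡ a
  card≡1⇒singleton a c y Say =
    length≡1⇒≡ (trans (sym (card≡length-select p (same p a))) c) (∈-select⁺ Say) (∈-select⁺ (same-refl p a))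

  card≡2⇒pair : ∀ a → card p (same p a) ≡ 2 →
    ∃ λ b → b ≢ a × same p a b ≡ true × (∀ y → same p a y ≡ true → y ≡ a ⊎ y ≡ b)
  card≡2⇒pair a c with length≡2⇒other (trans (sym (card≡length-select p (same p a))) c)
                         (select-unique (same p a)) (∈-select⁺ (same-refl p a))
  ... | b , b≢a , b∈ , only = b , b≢a , ∈-select⁻ b∈ , λ y Say → only (∈-select⁺ Say)

  pairing-by-card : (∀ a → card p (same p a) ≡ 1 ⊎ card p (same p a) ≡ 2) → Pairing (same p)
  pairing-by-card card∈ = record
    { partner = λ a → proj₁ (block a)
    ; related-partner = λ a → proj₁ (proj₂ (block a))
    ; related⇒partner = λ a → proj₂ (proj₂ (block a))
    }
    where
    block : ∀ a → ∃ λ b → same p a b ≡ true × (∀ y → same p a y ≡ true → y ≡ a ⊎ y ≡ b)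
    block a with card∈ a
    ... | inj₁ c = a , same-refl p a , λ y Say → inj₁ (card≡1⇒singleton a c y Say)
    ... | inj₂ c with card≡2⇒pair a c
    ...   | b , _ , Sab , only = b , Sab , only

  noSingletons-by-card : (∀ a → card p (same p a) ≡ 2) → NoSingletons (same p)
  noSingletons-by-card card≡2 a with card≡2⇒pair a (card≡2 a)
  ... | b , b≢a , Sab , _ = b , b≢a , Sab

  σ-pair : ∀ {a b} → a ≢ b → (∀ y → same p a y ≡ true → y ≡ a ⊎ y ≡ b) → same p a b ≡ true →
    card p (same p a) ≡ 2 × σ p (same p a) ≡ weight p a + weight p b
  σ-pair {a} a≢b only Sab
    rewrite card≡length-select p (same p a) | σ≡sumBy-select p (same p a) =
    sumBy-pair (weight p) (unique-listing-pair (select-unique (same p a))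
      (∈-select⁺ (same-refl p a)) (∈-select⁺ Sab) a≢b (λ y∈ → only _ (∈-select⁻ y∈)))

  σ-two-points : ∀ {a₁ a₂} → a₁ ≢ a₂ → σ p (λ γ → eqPt γ a₁ ∨ eqPt γ a₂) ≡ weight p a₁ + weight p a₂
  σ-two-points {a₁} {a₂} a₁≢a₂ = trans (σ≡sumBy-select p S)
    (proj₂ (sumBy-pair (weight p) (unique-listing-pair (select-unique S)
      (∈-select⁺ S-a₁) (∈-select⁺ S-a₂) a₁≢a₂ only)))
    where
    S : PtOf p → Bool
    S γ = eqPt γ a₁ ∨ eqPt γ a₂
    S-a₁ : S a₁ ≡ true
    S-a₁ rewrite eqPt-refl a₁ = refl
    S-a₂ : S a₂ ≡ true
    S-a₂ rewrite eqPt-refl a₂ = Bool.∨-zeroʳ (eqPt a₂ a₁)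
    only : ∀ {y} → y ∈ select S → y ≡ a₁ ⊎ y ≡ a₂
    only {y} y∈ with eqPt y a₁ in e₁ | eqPt y a₂ in e₂ | ∈-select⁻ {S = S} y∈
    ... | true  | _    | _ = inj₁ (eqPt⇒≡ y a₁ e₁)
    ... | false | true | _ = inj₂ (eqPt⇒≡ y a₂ e₂)

  σ-opposite-two-points : OppositePairs (same p) (ncol p) → ∀ {a₁ a₂} → a₁ ≢ a₂ → same p a₁ a₂ ≡ true →
    σ p (λ γ → eqPt γ a₁ ∨ eqPt γ a₂) ≡ + 0
  σ-opposite-two-points opp {a₁} {a₂} a₁≢a₂ S₁₂ = begin
    σ p (λ γ → eqPt γ a₁ ∨ eqPt γ a₂) ≡⟨ σ-two-points a₁≢a₂ ⟩
    weight p a₁ + weight p a₂          ≡⟨ cong (λ c → weight p a₁ + wt c) (opp a₁ a₂ (≢-sym a₁≢a₂) S₁₂) ⟩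
    weight p a₁ + wt (inv (ncol p a₁)) ≡⟨ wt+wt-inv≡0 (ncol p a₁) ⟩
    + 0                                ∎
    where open ≡-Reasoning

  module _ (P : Pairing (same p)) where
    open Pairing P

    block-fixed : ∀ a → partner a ≡ a → card p (same p a) ≡ 1 × σ p (same p a) ≡ weight p a
    block-fixed a πa≡a =
      trans (card≡length-select p (same p a)) (cong length listing) ,
      trans (σ≡sumBy-select p (same p a))
            (trans (cong (sumBy (weight p)) listing) (ℤ.+-identityʳ (weight p a)))
      where
      only : ∀ {y} → y ∈ select (same p a) → y ≡ a
      only {y} y∈ with related⇒partner a y (∈-select⁻ y∈)
      ... | inj₁ y≡a  = y≡a
      ... | inj₂ y≡πa = trans y≡πa πa≡a
      listing : select (same p a) ≡ a ∷ []
      listing = unique-listing-singleton (select-unique (same p a)) (∈-select⁺ (same-refl p a)) only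

    block-moved : ∀ a → partner a ≢ a →
      card p (same p a) ≡ 2 × σ p (same p a) ≡ weight p a + weight p (partner a)
    block-moved a πa≢a = σ-pair (λ a≡πa → πa≢a (sym a≡πa)) (related⇒partner a) (related-partner a)

    card-block∈1,2 : ∀ a → card p (same p a) ≡ 1 ⊎ card p (same p a) ≡ 2
    card-block∈1,2 a with partner a ≟ₚ a
    ... | yes πa≡a = inj₁ (proj₁ (block-fixed a πa≡a))
    ... | no  πa≢a = inj₂ (proj₁ (block-moved a πa≢a))

    ∣σ-block∣-fixed : ∀ a → partner a ≡ a → ∣ σ p (same p a) ∣ ≡ 1
    ∣σ-block∣-fixed a πa≡a = trans (cong ∣_∣ (proj₂ (block-fixed a πa≡a))) (∣wt∣≡1 (ncol p a))

    ∣σ-block∣-moved : ∀ a → partner a ≢ a → ∣ σ p (same p a) ∣ ≡ 0 ⊎ ∣ σ p (same p a) ∣ ≡ 2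
    ∣σ-block∣-moved a πa≢a rewrite proj₂ (block-moved a πa≢a) = ∣wt+wt∣≡0∨2 (ncol p a) (ncol p (partner a))

    σ-block-opposite : OppositePairs (same p) (ncol p) → ∀ a → partner a ≢ a → σ p (same p a) ≡ + 0
    σ-block-opposite opp a πa≢a
      rewrite proj₂ (block-moved a πa≢a) | opp a (partner a) πa≢a (related-partner a) =
      wt+wt-inv≡0 (ncol p a)

    oppositePairs-by-σ : (∀ a → partner a ≢ a → σ p (same p a) ≡ + 0) → OppositePairs (same p) (ncol p)
    oppositePairs-by-σ σ≡0 = oppositePairs-by-partner P λ a πa≢a →
      wt+wt≡0⇒inv (ncol p a) (ncol p (partner a)) (trans (sym (proj₂ (block-moved a πa≢a))) (σ≡0 a πa≢a))

EvenTotal ZeroTotal : Part → Set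
EvenTotal p = + 2 ∣ Σp p
ZeroTotal p = Σp p ≡ + 0

R-Qa⇔ : ∀ p → R Qa p ⇔ (Pairing (same p) × ⊤)
R-Qa⇔ p = mk⇔ (λ r → pairing-by-card p (ZLe.zF r) , tt) λ { (P , _) → record
  { zF = card-block∈1,2 p P
  ; zV = λ a → ∣σ-block∣ P a
  ; zΣ = tt ; zL = λ _ _ _ _ _ _ → tt ; zK = λ _ _ _ _ _ _ → tt ; zX = λ _ _ _ → tt } }
  where
  ∣σ-block∣ : (P : Pairing (same p)) → ∀ a → QV Qa (σ p (same p a))
  ∣σ-block∣ P a with Pairing.partner P a ≟ₚ a
  ... | yes πa≡a = inj₂ (inj₁ (∣σ-block∣-fixed p P a πa≡a))
  ... | no  πa≢a = map⊎₂ inj₂ (∣σ-block∣-moved p P a πa≢a)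

R-Qb⇔ : ∀ p → R Qb p ⇔ (Pairing (same p) × NoSingletons (same p) × EvenTotal p)
R-Qb⇔ p = mk⇔
  (λ r → pairing-by-card p (inj₂ ∘ ZLe.zF r) , noSingletons-by-card p (ZLe.zF r) , ZLe.zΣ r)
  λ { (P , ns , even) → record
    { zF = λ a → proj₁ (block-moved p P a (partner-moves P ns a))
    ; zV = λ a → ∣σ-block∣-moved p P a (partner-moves P ns a)
    ; zΣ = even ; zL = λ _ _ _ _ _ _ → tt ; zK = λ _ _ _ _ _ _ → tt ; zX = λ _ _ _ → tt } }

R-Qc⇔ : ∀ p → R Qc p ⇔
  (Pairing (same p) × NoSingletons (same p) × OppositePairs (same p) (ncol p) × ZeroTotal p)
R-Qc⇔ p = mk⇔
  (λ r → let P = pairing-by-card p (inj₂ ∘ ZLe.zF r) in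
    P , noSingletons-by-card p (ZLe.zF r) , oppositePairs-by-σ p P (λ a _ → ZLe.zV r a) , ZLe.zΣ r)
  λ { (P , ns , opp , Σ≡0) → record
    { zF = λ a → proj₁ (block-moved p P a (partner-moves P ns a))
    ; zV = λ a → σ-block-opposite p P opp a (partner-moves P ns a)
    ; zΣ = Σ≡0
    ; zL = λ _ _ a₁≢a₂ S₁₂ _ σ≢0 → σ≢0 (σ-opposite-two-points p opp a₁≢a₂ S₁₂)
    ; zK = λ _ _ _ _ _ _ → tt ; zX = λ _ _ _ → tt } }

R-Qd⇔ : ∀ p → R Qd p ⇔ (Pairing (same p) × OppositePairs (same p) (ncol p))
R-Qd⇔ p = mk⇔
  (λ r → let P = pairing-by-card p (ZLe.zF r) in P , oppositePairs-by-σ p P (σ-moved≡0 r P))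
  λ { (P , opp) → record
    { zF = card-block∈1,2 p P
    ; zV = λ a → ∣σ-block∣ P opp a
    ; zΣ = tt
    ; zL = λ _ _ a₁≢a₂ S₁₂ _ σ≢0 → σ≢0 (σ-opposite-two-points p opp a₁≢a₂ S₁₂)
    ; zK = λ _ _ _ _ _ _ → tt ; zX = λ _ _ _ → tt } }
  where
  σ-moved≡0 : R Qd p → (P : Pairing (same p)) → ∀ a → Pairing.partner P a ≢ a → σ p (same p a) ≡ + 0
  σ-moved≡0 r P a πa≢a with ZLe.zV r a | ∣σ-block∣-moved p P a πa≢a
  ... | inj₁ ∣σ∣≡0 | _ = ℤ.∣i∣≡0⇒i≡0 ∣σ∣≡0
  ... | inj₂ ∣σ∣≡1 | inj₁ ∣σ∣≡0 = ⊥-elim (ℕ.0≢1+n (trans (sym ∣σ∣≡0) ∣σ∣≡1))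
  ... | inj₂ ∣σ∣≡1 | inj₂ ∣σ∣≡2 = ⊥-elim (ℕ.1+n≢n (trans (sym ∣σ∣≡2) ∣σ∣≡1))
  ∣σ-block∣ : (P : Pairing (same p)) → OppositePairs (same p) (ncol p) → ∀ a → QV Qd (σ p (same p a))
  ∣σ-block∣ P opp a with Pairing.partner P a ≟ₚ a
  ... | yes πa≡a = inj₂ (∣σ-block∣-fixed p P a πa≡a)
  ... | no  πa≢a = inj₁ (cong ∣_∣ (σ-block-opposite p P opp a πa≢a))

sumBy-++ : ∀ {A : Set} (f : A → ℤ) xs ys → sumBy f (xs ++ ys) ≡ sumBy f xs + sumBy f ys
sumBy-++ f [] ys = sym (ℤ.+-identityˡ _)
sumBy-++ f (x ∷ xs) ys = trans (cong (λ s → f x + s) (sumBy-++ f xs ys)) (sym (ℤ.+-assoc (f x) _ _))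

sumBy-map : ∀ {A B : Set} (f : B → ℤ) (g : A → B) xs → sumBy f (map g xs) ≡ sumBy (f ∘ g) xs
sumBy-map f g [] = refl
sumBy-map f g (x ∷ xs) = cong (λ s → f (g x) + s) (sumBy-map f g xs)

sumBy-tabulate : ∀ {A : Set} n (f : A → ℤ) (g : Fin n → A) → sumBy f (tabulate g) ≡ sum (f ∘ g)
sumBy-tabulate zero    f g = refl
sumBy-tabulate (suc n) f g = cong (λ s → f (g Fin.zero) + s) (sumBy-tabulate n f (g ∘ Fin.suc))

sum-↑ : ∀ m n (h : Fin (m +ℕ n) → ℤ) → sum h ≡ sum (λ i → h (i ↑ˡ n)) + sum (λ j → h (m ↑ʳ j))
sum-↑ zero    n h = sym (ℤ.+-identityˡ _)
sum-↑ (suc m) n h =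
  trans (cong (λ s → h Fin.zero + s) (sum-↑ m n (h ∘ Fin.suc))) (sym (ℤ.+-assoc (h Fin.zero) _ _))

sum-neg : ∀ n (f : Fin n → ℤ) → sum (λ i → - f i) ≡ - sum f
sum-neg zero    f = refl
sum-neg (suc n) f = trans (cong (λ s → - f Fin.zero + s) (sum-neg n (f ∘ Fin.suc)))
                          (sym (ℤ.neg-distrib-+ (f Fin.zero) (sum (f ∘ Fin.suc))))

sum-cast : ∀ {m n} (e : m ≡ n) (f : Fin n → ℤ) → sum (λ j → f (cast e j)) ≡ sum f
sum-cast refl f = sum-cong-≗ (λ j → cong f (Fin.cast-is-id refl j))

sum-wt-inv : ∀ n (c : Fin n → Color) → sum (λ j → wt (inv (c j))) ≡ - sum (λ j → wt (c j))
sum-wt-inv n c = trans (sum-cong-≗ (λ j → wt-inv (c j))) (sum-neg n (λ j → wt (c j)))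

lowerΣ upperΣ : Part → ℤ
lowerΣ p = sum (λ i → wt (lc p i))
upperΣ p = sum (λ j → wt (uc p j))

Σp≡lower-upper : ∀ p → Σp p ≡ lowerΣ p + - upperΣ p
Σp≡lower-upper p = begin
  sumBy (weight p) (map inj₁ (allFin (k p)) ++ map inj₂ (allFin (l p)))
    ≡⟨ sumBy-++ (weight p) (map inj₁ (allFin (k p))) (map inj₂ (allFin (l p))) ⟩
  sumBy (weight p) (map inj₁ (allFin (k p))) + sumBy (weight p) (map inj₂ (allFin (l p)))
    ≡⟨ cong₂ _+_ (trans (sumBy-map (weight p) inj₁ (allFin (k p))) (sumBy-tabulate (k p) _ id))
                 (trans (sumBy-map (weight p) inj₂ (allFin (l p))) (sumBy-tabulate (l p) _ id)) ⟩
  lowerΣ p + sum (λ j → wt (inv (uc p j)))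
    ≡⟨ cong (λ s → lowerΣ p + s) (sum-wt-inv (l p) (uc p)) ⟩
  lowerΣ p + - upperΣ p ∎
  where open ≡-Reasoning

joinCol-↑ˡ : ∀ {m n} (f : Fin m → Color) (g : Fin n → Color) i → joinCol f g (i ↑ˡ n) ≡ f i
joinCol-↑ˡ {m} {n} f g i rewrite Fin.splitAt-↑ˡ m i n = refl

joinCol-↑ʳ : ∀ {m n} (f : Fin m → Color) (g : Fin n → Color) j → joinCol f g (m ↑ʳ j) ≡ g j
joinCol-↑ʳ {m} {n} f g j rewrite Fin.splitAt-↑ʳ m n j = refl

sum-wt-joinCol : ∀ {m n} (f : Fin m → Color) (g : Fin n → Color) →
  sum (wt ∘ joinCol f g) ≡ sum (wt ∘ f) + sum (wt ∘ g)
sum-wt-joinCol {m} {n} f g = trans (sum-↑ m n (wt ∘ joinCol f g))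
  (cong₂ _+_ (sum-cong-≗ (cong wt ∘ joinCol-↑ˡ f g)) (sum-cong-≗ (cong wt ∘ joinCol-↑ʳ f g)))

Σ-⊗ : ∀ p q → Σp (p ⊗ q) ≡ Σp p + Σp q
Σ-⊗ p q = begin
  Σp (p ⊗ q)                                         ≡⟨ Σp≡lower-upper (p ⊗ q) ⟩
  lowerΣ (p ⊗ q) + - upperΣ (p ⊗ q)                  ≡⟨ cong₂ (λ x y → x + - y) (sum-wt-joinCol (lc p) (lc q))
                                                                                 (sum-wt-joinCol (uc p) (uc q)) ⟩
  (lowerΣ p + lowerΣ q) + - (upperΣ p + upperΣ q)    ≡⟨ cong (λ s → (lowerΣ p + lowerΣ q) + s)
                                                             (ℤ.neg-distrib-+ (upperΣ p) (upperΣ q)) ⟩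
  (lowerΣ p + lowerΣ q) + (- upperΣ p + - upperΣ q)  ≡⟨ interchange (lowerΣ p) (lowerΣ q) (- upperΣ p) (- upperΣ q) ⟩
  (lowerΣ p + - upperΣ p) + (lowerΣ q + - upperΣ q)  ≡⟨ sym (cong₂ _+_ (Σp≡lower-upper p) (Σp≡lower-upper q)) ⟩
  Σp p + Σp q                                        ∎
  where open ≡-Reasoning

Σ-* : ∀ p → Σp (p *) ≡ - Σp p
Σ-* p = begin
  Σp (p *)                    ≡⟨ Σp≡lower-upper (p *) ⟩
  upperΣ p + - lowerΣ p       ≡⟨ ℤ.+-comm (upperΣ p) (- lowerΣ p) ⟩
  - lowerΣ p + upperΣ p       ≡⟨ cong (λ s → - lowerΣ p + s) (sym (ℤ.neg-involutive (upperΣ p))) ⟩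
  - lowerΣ p + - - upperΣ p   ≡⟨ sym (ℤ.neg-distrib-+ (lowerΣ p) (- upperΣ p)) ⟩
  - (lowerΣ p + - upperΣ p)   ≡⟨ cong -_ (sym (Σp≡lower-upper p)) ⟩
  - Σp p                      ∎
  where open ≡-Reasoning

oppositePairs-cong : ∀ {X : Set} {S : X → X → Bool} {c c′ : X → Color} →
  (∀ x → c x ≡ c′ x) → OppositePairs S c → OppositePairs S c′
oppositePairs-cong c≗c′ opp a b b≢a Sab = trans (sym (c≗c′ b)) (trans (opp a b b≢a Sab) (cong inv (c≗c′ a)))

oppositePairs-inv : ∀ {X : Set} {S : X → X → Bool} {c : X → Color} →
  OppositePairs S c → OppositePairs S (inv ∘ c)
oppositePairs-inv opp a b b≢a Sab = cong inv (opp a b b≢a Sab)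

module _ {X Y : Set} (φ : Y → X) (ψ : X → Y) (ψ∘φ : ∀ y → ψ (φ y) ≡ y) (φ∘ψ : ∀ x → φ (ψ x) ≡ x)
         {S : X → X → Bool} where

  private
    φ-injective : ∀ {y y′} → φ y ≡ φ y′ → y ≡ y′
    φ-injective {y} {y′} e = trans (sym (ψ∘φ y)) (trans (cong ψ e) (ψ∘φ y′))

  pairing-pullback : Pairing S → Pairing (λ y y′ → S (φ y) (φ y′))
  pairing-pullback P = record
    { partner = λ y → ψ (partner (φ y))
    ; related-partner = λ y → subst (λ x → S (φ y) x ≡ true) (sym (φ∘ψ _)) (related-partner (φ y))
    ; related⇒partner = λ y y′ s → map⊎ φ-injective
        (λ e → φ-injective (trans e (sym (φ∘ψ _)))) (related⇒partner (φ y) (φ y′) s)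
    }
    where open Pairing P

  noSingletons-pullback : NoSingletons S → NoSingletons (λ y y′ → S (φ y) (φ y′))
  noSingletons-pullback ns y with ns (φ y)
  ... | b , b≢φy , S-b = ψ b , (λ ψb≡y → b≢φy (trans (sym (φ∘ψ b)) (cong φ ψb≡y))) ,
                         subst (λ x → S (φ y) x ≡ true) (sym (φ∘ψ b)) S-b

  oppositePairs-pullback : ∀ {c} → OppositePairs S c → OppositePairs (λ y y′ → S (φ y) (φ y′)) (c ∘ φ)
  oppositePairs-pullback opp y y′ y′≢y = opp (φ y) (φ y′) (y′≢y ∘ φ-injective)

module _ (p q : Part) where

  colourSum : PtOf p ⊎ PtOf q → Color
  colourSum = [ ncol p , ncol q ]′

  pairing-⊎ : Pairing (same p) → Pairing (same q) → Pairing (sameSum p q)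
  pairing-⊎ P Q = record
    { partner = map⊎ (partner P) (partner Q) ; related-partner = related ; related⇒partner = only }
    where
    open Pairing
    related : ∀ z → sameSum p q z (map⊎ (partner P) (partner Q) z) ≡ true
    related (inj₁ a) = related-partner P a
    related (inj₂ b) = related-partner Q b
    only : ∀ z w → sameSum p q z w ≡ true → w ≡ z ⊎ w ≡ map⊎ (partner P) (partner Q) z
    only (inj₁ a) (inj₁ b) s = map⊎ (cong inj₁) (cong inj₁) (related⇒partner P a b s)
    only (inj₂ a) (inj₂ b) s = map⊎ (cong inj₂) (cong inj₂) (related⇒partner Q a b s)

  noSingletons-⊎ : NoSingletons (same p) → NoSingletons (same q) → NoSingletons (sameSum p q)
  noSingletons-⊎ nsp nsq (inj₁ a) with nsp a
  ... | b , b≢a , S-b = inj₁ b , b≢a ∘ Sum.inj₁-injective , S-b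
  noSingletons-⊎ nsp nsq (inj₂ a) with nsq a
  ... | b , b≢a , S-b = inj₂ b , b≢a ∘ Sum.inj₂-injective , S-b

  oppositePairs-⊎ : OppositePairs (same p) (ncol p) → OppositePairs (same q) (ncol q) →
    OppositePairs (sameSum p q) colourSum
  oppositePairs-⊎ opp _ (inj₁ a) (inj₁ b) b≢a = opp a b (b≢a ∘ cong inj₁)
  oppositePairs-⊎ _ opq (inj₂ a) (inj₂ b) b≢a = opq a b (b≢a ∘ cong inj₂)

  joinPt : PtOf p ⊎ PtOf q → PtOf (p ⊗ q)
  joinPt (inj₁ (inj₁ a)) = inj₁ (a ↑ˡ k q)
  joinPt (inj₁ (inj₂ a)) = inj₂ (a ↑ˡ l q)
  joinPt (inj₂ (inj₁ b)) = inj₁ (k p ↑ʳ b)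
  joinPt (inj₂ (inj₂ b)) = inj₂ (l p ↑ʳ b)

  splitPt-joinPt : ∀ z → splitPt p q (joinPt z) ≡ z
  splitPt-joinPt (inj₁ (inj₁ a)) rewrite Fin.splitAt-↑ˡ (k p) a (k q) = refl
  splitPt-joinPt (inj₁ (inj₂ a)) rewrite Fin.splitAt-↑ˡ (l p) a (l q) = refl
  splitPt-joinPt (inj₂ (inj₁ b)) rewrite Fin.splitAt-↑ʳ (k p) (k q) b = refl
  splitPt-joinPt (inj₂ (inj₂ b)) rewrite Fin.splitAt-↑ʳ (l p) (l q) b = refl

  joinPt-splitPt : ∀ x → joinPt (splitPt p q x) ≡ x
  joinPt-splitPt (inj₁ i) with splitAt (k p) i in eq
  ... | inj₁ a = cong inj₁ (trans (cong (join (k p) (k q)) (sym eq)) (Fin.join-splitAt (k p) (k q) i))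
  ... | inj₂ b = cong inj₁ (trans (cong (join (k p) (k q)) (sym eq)) (Fin.join-splitAt (k p) (k q) i))
  joinPt-splitPt (inj₂ j) with splitAt (l p) j in eq
  ... | inj₁ a = cong inj₂ (trans (cong (join (l p) (l q)) (sym eq)) (Fin.join-splitAt (l p) (l q) j))
  ... | inj₂ b = cong inj₂ (trans (cong (join (l p) (l q)) (sym eq)) (Fin.join-splitAt (l p) (l q) j))

  ncol-⊗ : ∀ x → colourSum (splitPt p q x) ≡ ncol (p ⊗ q) x
  ncol-⊗ (inj₁ i) with splitAt (k p) i
  ... | inj₁ a = refl
  ... | inj₂ b = refl
  ncol-⊗ (inj₂ j) with splitAt (l p) j
  ... | inj₁ a = refl
  ... | inj₂ b = refl

  pairing-⊗ : Pairing (same p) → Pairing (same q) → Pairing (same (p ⊗ q))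
  pairing-⊗ P Q = pairing-pullback (splitPt p q) joinPt joinPt-splitPt splitPt-joinPt (pairing-⊎ P Q)

  noSingletons-⊗ : NoSingletons (same p) → NoSingletons (same q) → NoSingletons (same (p ⊗ q))
  noSingletons-⊗ nsp nsq =
    noSingletons-pullback (splitPt p q) joinPt joinPt-splitPt splitPt-joinPt (noSingletons-⊎ nsp nsq)

  oppositePairs-⊗ : OppositePairs (same p) (ncol p) → OppositePairs (same q) (ncol q) →
    OppositePairs (same (p ⊗ q)) (ncol (p ⊗ q))
  oppositePairs-⊗ opp opq = oppositePairs-cong ncol-⊗
    (oppositePairs-pullback (splitPt p q) joinPt joinPt-splitPt splitPt-joinPt (oppositePairs-⊎ opp opq))

swapPt-involutive : ∀ {k l} (x : Pt k l) → swapPt (swapPt x) ≡ x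
swapPt-involutive (inj₁ i) = refl
swapPt-involutive (inj₂ j) = refl

module _ (p : Part) where

  ncol-* : ∀ x → inv (ncol p (swapPt x)) ≡ ncol (p *) x
  ncol-* (inj₁ j) = inv-involutive (uc p j)
  ncol-* (inj₂ i) = refl

  pairing-* : Pairing (same p) → Pairing (same (p *))
  pairing-* = pairing-pullback swapPt swapPt swapPt-involutive swapPt-involutive

  noSingletons-* : NoSingletons (same p) → NoSingletons (same (p *))
  noSingletons-* = noSingletons-pullback swapPt swapPt swapPt-involutive swapPt-involutive

  oppositePairs-* : OppositePairs (same p) (ncol p) → OppositePairs (same (p *)) (ncol (p *))
  oppositePairs-* opp = oppositePairs-cong ncol-*
    (oppositePairs-inv (oppositePairs-pullback swapPt swapPt swapPt-involutive swapPt-involutive opp))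

module AlternatingWalk {V : Set} (_≟_ : DecidableEquality V)
  (f g : V → V) (f-involutive : ∀ v → f (f v) ≡ v) (g-involutive : ∀ v → g (g v) ≡ v)
  (x₀ : V) (g-x₀ : g x₀ ≡ x₀) where

  move : Bool → V → V
  move true  = f
  move false = g

  move-involutive : ∀ b v → move b (move b v) ≡ v
  move-involutive true  = f-involutive
  move-involutive false = g-involutive

  side : ℕ → Bool
  side zero    = true
  side (suc n) = not (side n)

  side≡false⇒0< : ∀ {n} → side n ≡ false → 0 < n
  side≡false⇒0< {suc n} _ = z<s

  walk : ℕ → V
  walk zero    = x₀
  walk (suc n) = move (side n) (walk n)

  walk-back : ∀ n {b} → side n ≡ b → move b (walk (suc n)) ≡ walk n
  walk-back n refl = move-involutive (side n) (walk n)

  Stops : ℕ → Set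
  Stops n = walk (suc n) ≡ walk n

  MovesBefore : ℕ → Set
  MovesBefore n = ∀ i → i < n → walk (suc i) ≢ walk i

  -- A coincidence walk i ≡ walk j yields walk (i - 1) ≡ walk (j - 1) when the steps into i and j
  -- agree, and walk (i + 1) ≡ walk (j - 1) otherwise; either way it ends in a stop before n.
  walk-injective : ∀ {n} → MovesBefore n → ∀ j i → i < j → j ≤ n → walk i ≢ walk j
  walk-injective moves (suc j) i i<1+j 1+j≤n eq with side i Bool.≟ side j
  ... | yes sᵢ≡sⱼ with ℕ.<-cmp (suc i) j
  ...   | tri< 1+i<j _ _ = walk-injective moves j (suc i) 1+i<j (ℕ.<⇒≤ 1+j≤n)
                             (trans (cong (move (side i)) eq) (walk-back j (sym sᵢ≡sⱼ)))
  ...   | tri≈ _ refl _  = Bool.not-¬ refl sᵢ≡sⱼ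
  ...   | tri> _ _ j<1+i with ℕ.≤-antisym (ℕ.≤-pred i<1+j) (ℕ.≤-pred j<1+i)
  ...     | refl = moves i 1+j≤n (sym eq)
  walk-injective moves (suc j) zero 0<1+j 1+j≤n eq | no sᵢ≢sⱼ with side j in sⱼ
  ... | true  = sᵢ≢sⱼ refl
  ... | false = walk-injective moves j zero (0<j j sⱼ) (ℕ.<⇒≤ 1+j≤n)
                  (trans (sym g-x₀) (trans (cong g eq) (g-involutive (walk j))))
    where
    0<j : ∀ j → side j ≡ false → 0 < j
    0<j (suc j) _ = z<s
  walk-injective moves (suc j) (suc i) (s<s i<j) 1+j≤n eq | no sᵢ≢sⱼ =
    walk-injective moves j i i<j (ℕ.<⇒≤ 1+j≤n)
      (trans (sym (walk-back i refl)) (trans (cong (move (side i)) eq) (walk-back j (sym sᵢ≡sⱼ))))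
    where
    sᵢ≡sⱼ : side i ≡ side j
    sᵢ≡sⱼ = Bool.not-injective (Bool.¬-not sᵢ≢sⱼ)

  first-stop : ∀ N → (∃ λ n → n < N × Stops n × MovesBefore n) ⊎ MovesBefore N
  first-stop zero = inj₂ (λ _ ())
  first-stop (suc N) with first-stop N
  ... | inj₁ (n , n<N , stops , moves) = inj₁ (n , ℕ.m<n⇒m<1+n n<N , stops , moves)
  ... | inj₂ moves with walk (suc N) ≟ walk N
  ...   | yes stops = inj₁ (N , ℕ.n<1+n N , stops , moves)
  ...   | no  moved = inj₂ λ i i<1+N → [ moves i , (λ { refl → moved }) ]′ (ℕ.m≤n⇒m<n∨m≡n (ℕ.≤-pred i<1+N))

  walk-stops : ∀ {m} (code : V → Fin m) → (∀ {v w} → code v ≡ code w → v ≡ w) →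
    ∃ λ n → Stops n × MovesBefore n
  walk-stops {m} code code-injective with first-stop m
  ... | inj₁ (n , _ , stops , moves) = n , stops , moves
  ... | inj₂ moves with Fin.pigeonhole (ℕ.n<1+n m) (code ∘ walk ∘ toℕ)
  ...   | i , j , i<j , same-code =
    ⊥-elim (walk-injective moves (toℕ j) (toℕ i) i<j (ℕ.≤-pred (Fin.toℕ<n j)) (code-injective same-code))

  walk-within : ∀ {n} → Stops n → ∀ m → ∃ λ i → i ≤ n × walk m ≡ walk i
  walk-within stops zero = zero , z≤n , refl
  walk-within {n} stops (suc m) with walk-within stops m
  ... | i , i≤n , wₘ≡wᵢ with side m Bool.≟ side i
  ...   | yes sₘ≡sᵢ with ℕ.m≤n⇒m<n∨m≡n i≤n
  ...     | inj₁ i<n  = suc i , i<n , cong₂ move sₘ≡sᵢ wₘ≡wᵢ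
  ...     | inj₂ refl = i , i≤n , trans (cong₂ move sₘ≡sᵢ wₘ≡wᵢ) stops
  walk-within stops (suc m) | zero , i≤n , wₘ≡w₀ | no sₘ≢s₀ =
    zero , z≤n , trans (cong₂ move (Bool.¬-not sₘ≢s₀) wₘ≡w₀) g-x₀
  walk-within stops (suc m) | suc i , 1+i≤n , wₘ≡wᵢ | no sₘ≢sᵢ =
    i , ℕ.<⇒≤ 1+i≤n , trans (cong (move (side m)) wₘ≡wᵢ)
                            (walk-back i (sym (trans (Bool.¬-not sₘ≢sᵢ) (Bool.not-involutive (side i)))))

  Adjacent : V → V → Set
  Adjacent v w = w ≡ v ⊎ w ≡ f v ⊎ w ≡ g v

  on-walk-move : ∀ b m → ∃ λ m′ → walk m′ ≡ move b (walk m)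
  on-walk-move b m with side m Bool.≟ b
  ... | yes refl = suc m , refl
  on-walk-move true  zero    | no s₀≢b = ⊥-elim (s₀≢b refl)
  on-walk-move false zero    | no _    = zero , sym g-x₀
  on-walk-move b     (suc m) | no sₘ≢b =
    m , sym (walk-back m (Bool.not-injective (Bool.¬-not sₘ≢b)))

  on-walk-closed : ∀ {R : V → V → Set} → (∀ {v w} → R v w → Adjacent v w) →
    ∀ {v w} → Star R v w → (∃ λ m → walk m ≡ v) → ∃ λ m → walk m ≡ w
  on-walk-closed adj ε on-walk = on-walk
  on-walk-closed adj (r ◅ rs) (m , refl) = on-walk-closed adj rs (step (adj r))
    where
    step : ∀ {w} → Adjacent (walk m) w → ∃ λ m′ → walk m′ ≡ w
    step (inj₁ refl)        = m , refl
    step (inj₂ (inj₁ refl)) = on-walk-move true m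
    step (inj₂ (inj₂ refl)) = on-walk-move false m

  reachable⇒on-walk : ∀ {R : V → V → Set} → (∀ {v w} → R v w → Adjacent v w) → ∀ {n} → Stops n →
    ∀ {w} → Star R x₀ w → ∃ λ i → i ≤ n × walk i ≡ w
  reachable⇒on-walk adj stops r with on-walk-closed adj r (zero , refl)
  ... | m , refl with walk-within stops m
  ...   | i , i≤n , wₘ≡wᵢ = i , i≤n , sym wₘ≡wᵢ

  walk-reachable : ∀ {R : V → V → Set} → (∀ v → Star R v (f v)) → (∀ v → Star R v (g v)) →
    ∀ m → Star R x₀ (walk m)
  walk-reachable r-f r-g zero = ε
  walk-reachable r-f r-g (suc m) = walk-reachable r-f r-g m ◅◅ r-move (side m) (walk m)
    where
    r-move : ∀ b v → Star _ v (move b v)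
    r-move true  = r-f
    r-move false = r-g

  interior-moved-by-g : ∀ {n} → MovesBefore n → ∀ i → 0 < i → i < n → g (walk i) ≢ walk i
  interior-moved-by-g moves i 0<i i<n with side i in sᵢ
  ... | false = subst (λ b → move b (walk i) ≢ walk i) sᵢ (moves i i<n)
  interior-moved-by-g moves (suc i) 0<i 1+i<n | true =
    λ g-fixed → moves i (ℕ.<-trans (ℕ.n<1+n i) 1+i<n) (sym (trans (sym (walk-back i sᵢ′)) g-fixed))
    where
    sᵢ′ : side i ≡ false
    sᵢ′ = Bool.not-injective sᵢ

  g-fixed-end-odd : ∀ {n} → MovesBefore n → 0 < n → g (walk n) ≡ walk n → side n ≡ false
  g-fixed-end-odd {suc n} moves _ g-fixed with side n Bool.≟ true
  ... | yes sₙ≡true = cong not sₙ≡true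
  ... | no  sₙ≢true = ⊥-elim (moves n (ℕ.n<1+n n) (trans (sym g-fixed) (walk-back n (Bool.¬-not sₙ≢true))))

  stop-end : ∀ {n} → Stops n → (side n ≡ false × g (walk n) ≡ walk n) ⊎ (side n ≡ true × f (walk n) ≡ walk n)
  stop-end {n} stops with side n in sₙ
  ... | false = inj₁ (refl , stops)
  ... | true  = inj₂ (refl , stops)

  module _ (c : V → Color) (f-flips : ∀ v → f v ≢ v → c (f v) ≡ inv (c v))
                           (g-flips : ∀ v → g v ≢ v → c (g v) ≡ inv (c v)) where

    walk-colour : ∀ {n} → MovesBefore n → ∀ i → i ≤ n → c (walk i) ≡ (if side i then c x₀ else inv (c x₀))
    walk-colour moves zero _ = refl
    walk-colour moves (suc i) 1+i≤n with side i | walk-colour moves i (ℕ.<⇒≤ 1+i≤n) | moves i 1+i≤n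
    ... | true  | cᵢ | moved = trans (f-flips (walk i) moved) (cong inv cᵢ)
    ... | false | cᵢ | moved = trans (g-flips (walk i) moved) (trans (cong inv cᵢ) (inv-involutive (c x₀)))

record Composition (p p′ : Part) : Set where
  field
    rows         : l p ≡ k p′
    colours      : ∀ j → uc p j ≡ lc p′ (cast rows j)
    rel          : Pt (k p) (l p′) → Pt (k p) (l p′) → Bool
    rel-refl     : ∀ x → rel x x ≡ true
    rel-sym      : ∀ x y → rel x y ≡ true → rel y x ≡ true
    rel-trans    : ∀ x y z → rel x y ≡ true → rel y z ≡ true → rel x z ≡ true
    is-composite : IsCompRel p p′ rows rel

  composite : Part
  composite = mkPart (k p) (l p′) (lc p) (uc p′) rel rel-refl rel-sym rel-trans

Σ-composite : ∀ {p p′} (C : Composition p p′) → Σp (Composition.composite C) ≡ Σp p + Σp p′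
Σ-composite {p} {p′} C = begin
  Σp composite                                       ≡⟨ Σp≡lower-upper composite ⟩
  lowerΣ p + - upperΣ p′                             ≡⟨ cong (λ s → lowerΣ p + s) (sym cancel) ⟩
  lowerΣ p + (- upperΣ p + (upperΣ p + - upperΣ p′)) ≡⟨ sym (ℤ.+-assoc (lowerΣ p) (- upperΣ p) _) ⟩
  (lowerΣ p + - upperΣ p) + (upperΣ p + - upperΣ p′) ≡⟨ cong₂ _+_ (sym (Σp≡lower-upper p)) glued ⟩
  Σp p + Σp p′                                       ∎
  where
  open ≡-Reasoning
  open Composition C using (composite; rows; colours)
  cancel : - upperΣ p + (upperΣ p + - upperΣ p′) ≡ - upperΣ p′
  cancel = trans (sym (ℤ.+-assoc (- upperΣ p) (upperΣ p) _))
                 (trans (cong (λ s → s + - upperΣ p′) (ℤ.+-inverseˡ (upperΣ p))) (ℤ.+-identityˡ _))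
  glued : upperΣ p + - upperΣ p′ ≡ Σp p′
  glued = trans (cong (λ s → s + - upperΣ p′) (trans (sum-cong-≗ (cong wt ∘ colours)) (sum-cast rows (wt ∘ lc p′))))
                (sym (Σp≡lower-upper p′))

join-injective : ∀ m n {x y : Fin m ⊎ Fin n} → join m n x ≡ join m n y → x ≡ y
join-injective m n {x} {y} e =
  trans (sym (Fin.splitAt-join m n x)) (trans (cong (splitAt m) e) (Fin.splitAt-join m n y))

module Glued {p p′ : Part} (C : Composition p p′) where
  open Composition C

  Vertex : Set
  Vertex = PtOf p ⊎ PtOf p′

  _≟ᵥ_ : DecidableEquality Vertex
  _≟ᵥ_ = Sum.≡-dec _≟ₚ_ _≟ₚ_

  ι : Vertex → Vertex
  ι (inj₁ (inj₁ i)) = inj₁ (inj₁ i)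
  ι (inj₁ (inj₂ j)) = inj₂ (inj₁ (cast rows j))
  ι (inj₂ (inj₁ j)) = inj₁ (inj₂ (cast (sym rows) j))
  ι (inj₂ (inj₂ j)) = inj₂ (inj₂ j)

  ι-involutive : ∀ v → ι (ι v) ≡ v
  ι-involutive (inj₁ (inj₁ i)) = refl
  ι-involutive (inj₁ (inj₂ j)) = cong (inj₁ ∘ inj₂) (Fin.cast-involutive (sym rows) rows j)
  ι-involutive (inj₂ (inj₁ j)) = cong (inj₂ ∘ inj₁) (Fin.cast-involutive rows (sym rows) j)
  ι-involutive (inj₂ (inj₂ j)) = refl

  ι-embed : ∀ x → ι (embed p p′ x) ≡ embed p p′ x
  ι-embed (inj₁ i) = refl
  ι-embed (inj₂ j) = refl

  ι-fixed⇒embed : ∀ v → ι v ≡ v → ∃ λ x → embed p p′ x ≡ v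
  ι-fixed⇒embed (inj₁ (inj₁ i)) _ = inj₁ i , refl
  ι-fixed⇒embed (inj₂ (inj₂ j)) _ = inj₂ j , refl

  embed-injective : ∀ {x y} → embed p p′ x ≡ embed p p′ y → x ≡ y
  embed-injective {inj₁ i} {inj₁ .i} refl = refl
  embed-injective {inj₂ j} {inj₂ .j} refl = refl

  colour : Vertex → Color
  colour = [ ncol p , ncol p′ ]′

  ncol-composite : ∀ x → ncol composite x ≡ colour (embed p p′ x)
  ncol-composite (inj₁ i) = refl
  ncol-composite (inj₂ j) = refl

  ι-flips : ∀ v → ι v ≢ v → colour (ι v) ≡ inv (colour v)
  ι-flips (inj₁ (inj₁ i)) moved = ⊥-elim (moved refl)
  ι-flips (inj₁ (inj₂ j)) _ = trans (sym (colours j)) (sym (inv-involutive (uc p j)))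
  ι-flips (inj₂ (inj₁ j)) _ = cong inv (trans (colours _) (cong (lc p′) (Fin.cast-involutive rows (sym rows) j)))
  ι-flips (inj₂ (inj₂ j)) moved = ⊥-elim (moved refl)

  code : Vertex → Fin ((k p +ℕ l p) +ℕ (k p′ +ℕ l p′))
  code = join _ _ ∘ map⊎ (join (k p) (l p)) (join (k p′) (l p′))

  code-injective : ∀ {v w} → code v ≡ code w → v ≡ w
  code-injective e = map-join-injective (join-injective (k p +ℕ l p) (k p′ +ℕ l p′) e)
    where
    map-join-injective : ∀ {v w} → map⊎ (join (k p) (l p)) (join (k p′) (l p′)) v
                                   ≡ map⊎ (join (k p) (l p)) (join (k p′) (l p′)) w → v ≡ w
    map-join-injective {inj₁ _} {inj₁ _} e = cong inj₁ (join-injective (k p) (l p) (Sum.inj₁-injective e))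
    map-join-injective {inj₂ _} {inj₂ _} e = cong inj₂ (join-injective (k p′) (l p′) (Sum.inj₂-injective e))

  EqGen : Vertex → Vertex → Set
  EqGen = Star (SymClosure (Gen p p′ rows))

  reach-ι : ∀ v → EqGen v (ι v)
  reach-ι (inj₁ (inj₁ i)) = ε
  reach-ι (inj₁ (inj₂ j)) = fwd (genId j) ◅ ε
  reach-ι (inj₂ (inj₁ j)) = bwd (subst (Gen p p′ rows (ι (inj₂ (inj₁ j))) ∘ inj₂ ∘ inj₁)
                                       (Fin.cast-involutive rows (sym rows) j) (genId (cast (sym rows) j))) ◅ ε
  reach-ι (inj₂ (inj₂ j)) = ε

  module _ (P : Pairing (same p)) (P′ : Pairing (same p′)) where

    π : Vertex → Vertex
    π = map⊎ (Pairing.partner P) (Pairing.partner P′)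

    π-involutive : ∀ v → π (π v) ≡ v
    π-involutive (inj₁ a) = cong inj₁ (partner-involutive P (same-sym p) a)
    π-involutive (inj₂ b) = cong inj₂ (partner-involutive P′ (same-sym p′) b)

    reach-π : ∀ v → EqGen v (π v)
    reach-π (inj₁ a) = fwd (genL a _ (Pairing.related-partner P a)) ◅ ε
    reach-π (inj₂ b) = fwd (genU b _ (Pairing.related-partner P′ b)) ◅ ε

    gen⇒adjacent : ∀ {u v} → SymClosure (Gen p p′ rows) u v → v ≡ u ⊎ v ≡ π u ⊎ v ≡ ι u
    gen⇒adjacent (fwd (genL a b s)) = map⊎ (cong inj₁) (inj₁ ∘ cong inj₁) (Pairing.related⇒partner P a b s)
    gen⇒adjacent (fwd (genU a b s)) = map⊎ (cong inj₂) (inj₁ ∘ cong inj₂) (Pairing.related⇒partner P′ a b s)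
    gen⇒adjacent (fwd (genId j))    = inj₂ (inj₂ refl)
    gen⇒adjacent (bwd (genL b a s)) =
      map⊎ (cong inj₁) (inj₁ ∘ cong inj₁) (Pairing.related⇒partner P a b (same-sym p b a s))
    gen⇒adjacent (bwd (genU b a s)) =
      map⊎ (cong inj₂) (inj₁ ∘ cong inj₂) (Pairing.related⇒partner P′ a b (same-sym p′ b a s))
    gen⇒adjacent (bwd (genId j))    =
      inj₂ (inj₂ (cong (inj₁ ∘ inj₂) (sym (Fin.cast-involutive (sym rows) rows j))))

    π-flips : OppositePairs (same p) (ncol p) → OppositePairs (same p′) (ncol p′) →
      ∀ v → π v ≢ v → colour (π v) ≡ inv (colour v)
    π-flips opp _ (inj₁ a) moved = opp a _ (moved ∘ cong inj₁) (Pairing.related-partner P a)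
    π-flips _ opp′ (inj₂ b) moved = opp′ b _ (moved ∘ cong inj₂) (Pairing.related-partner P′ b)

    π-fixed⇒singleton : ∀ v → π v ≡ v → NoSingletons (same p) → NoSingletons (same p′) → ⊥
    π-fixed⇒singleton (inj₁ a) fixed ns _ = partner-moves P ns a (Sum.inj₁-injective fixed)
    π-fixed⇒singleton (inj₂ b) fixed _ ns′ = partner-moves P′ ns′ b (Sum.inj₂-injective fixed)

    Singleton : Pt (k p) (l p′) → Set
    Singleton x = (∀ z → rel x z ≡ true → z ≡ x) × (NoSingletons (same p) → NoSingletons (same p′) → ⊥)

    PairedWith : Pt (k p) (l p′) → Pt (k p) (l p′) → Set
    PairedWith x y = y ≢ x × rel x y ≡ true × (∀ z → rel x z ≡ true → z ≡ x ⊎ z ≡ y) ×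
      (OppositePairs (same p) (ncol p) → OppositePairs (same p′) (ncol p′) →
       ncol composite y ≡ inv (ncol composite x))

    module Orbit (x : Pt (k p) (l p′)) where
      open AlternatingWalk _≟ᵥ_ π ι π-involutive ι-involutive (embed p p′ x) (ι-embed x) public

      outer-on-walk : ∀ {n} → Stops n → MovesBefore n → ∀ z → rel x z ≡ true →
        z ≡ x ⊎ (0 < n × walk n ≡ embed p p′ z)
      outer-on-walk {n} stops moves z r
        with reachable⇒on-walk gen⇒adjacent {n} stops (Equivalence.to (is-composite x z) r)
      ... | zero , _ , w₀≡z = inj₁ (embed-injective (sym w₀≡z))
      ... | suc i , i≤n , wᵢ≡z with ℕ.m≤n⇒m<n∨m≡n i≤n
      ...   | inj₁ i<n  = ⊥-elim (interior-moved-by-g moves (suc i) z<s i<n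
                                    (trans (cong ι wᵢ≡z) (trans (ι-embed z) (sym wᵢ≡z))))
      ...   | inj₂ refl = inj₂ (z<s , wᵢ≡z)

      classify-with : ∀ {n} → Stops n → MovesBefore n → Singleton x ⊎ ∃ (PairedWith x)
      classify-with {n} stops moves with stop-end {n} stops
      ... | inj₂ (sₙ≡true , f-fixed) = inj₁ (only , π-fixed⇒singleton _ f-fixed)
        where
        only : ∀ z → rel x z ≡ true → z ≡ x
        only z r with outer-on-walk {n} stops moves z r
        ... | inj₁ z≡x = z≡x
        ... | inj₂ (0<n , wₙ≡z) with trans (sym sₙ≡true) (g-fixed-end-odd {n} moves 0<n
                                         (trans (cong ι wₙ≡z) (trans (ι-embed z) (sym wₙ≡z))))
        ...   | ()
      ... | inj₁ (sₙ≡false , g-fixed) with ι-fixed⇒embed (walk n) g-fixed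
      ...   | y , y≡wₙ = inj₂ (y , y≢x , Equivalence.from (is-composite x y) x~y , only , colour-y)
        where
        0<n : 0 < n
        0<n = side≡false⇒0< {n} sₙ≡false
        y≢x : y ≢ x
        y≢x refl = walk-injective moves n zero 0<n ℕ.≤-refl y≡wₙ
        x~y : EqGen (embed p p′ x) (embed p p′ y)
        x~y = subst (EqGen (embed p p′ x)) (sym y≡wₙ) (walk-reachable reach-π reach-ι n)
        only : ∀ z → rel x z ≡ true → z ≡ x ⊎ z ≡ y
        only z r = map⊎₂ (λ (_ , wₙ≡z) → embed-injective (trans (sym wₙ≡z) (sym y≡wₙ)))
                                 (outer-on-walk {n} stops moves z r)
        colour-y : OppositePairs (same p) (ncol p) → OppositePairs (same p′) (ncol p′) →
                   ncol composite y ≡ inv (ncol composite x)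
        colour-y opp opp′ = begin
          ncol composite y                ≡⟨ ncol-composite y ⟩
          colour (embed p p′ y)           ≡⟨ cong colour y≡wₙ ⟩
          colour (walk n)                 ≡⟨ walk-colour colour (π-flips opp opp′) ι-flips {n} moves n ℕ.≤-refl ⟩
          (if side n then c₀ else inv c₀) ≡⟨ cong (λ b → if b then c₀ else inv c₀) sₙ≡false ⟩
          inv c₀                          ≡⟨ cong inv (sym (ncol-composite x)) ⟩
          inv (ncol composite x)          ∎
          where
          open ≡-Reasoning
          c₀ = colour (embed p p′ x)

    classify : ∀ x → Singleton x ⊎ ∃ (PairedWith x)
    classify x with Orbit.walk-stops x code code-injective
    ... | n , stops , moves = Orbit.classify-with x {n} stops moves

    pairing-∘ : Pairing rel
    pairing-∘ = record
      { partner = λ x → proj₁ (block x)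
      ; related-partner = λ x → proj₁ (proj₂ (block x))
      ; related⇒partner = λ x → proj₂ (proj₂ (block x))
      }
      where
      block : ∀ x → ∃ λ y → rel x y ≡ true × (∀ z → rel x z ≡ true → z ≡ x ⊎ z ≡ y)
      block x with classify x
      ... | inj₁ (only , _) = x , rel-refl x , λ z r → inj₁ (only z r)
      ... | inj₂ (y , _ , r , only , _) = y , r , only

    noSingletons-∘ : NoSingletons (same p) → NoSingletons (same p′) → NoSingletons rel
    noSingletons-∘ ns ns′ x with classify x
    ... | inj₁ (_ , singleton⇒⊥) = ⊥-elim (singleton⇒⊥ ns ns′)
    ... | inj₂ (y , y≢x , r , _) = y , y≢x , r

    oppositePairs-∘ : OppositePairs (same p) (ncol p) → OppositePairs (same p′) (ncol p′) →
      OppositePairs rel (ncol composite)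
    oppositePairs-∘ opp opp′ x z z≢x r with classify x
    ... | inj₁ (only , _) = ⊥-elim (z≢x (only z r))
    ... | inj₂ (y , _ , _ , only , colour-y) with only z r
    ...   | inj₁ z≡x  = ⊥-elim (z≢x z≡x)
    ...   | inj₂ refl = colour-y opp opp′

record ClosedUnderPairings (P : Part → Set) : Set₁ where
  field
    empty       : P emptyP
    identity    : ∀ c → P (idP c)
    pair        : ∀ c → P (pairP c (inv c))
    tensor      : ∀ {p q} → Pairing (same p) → Pairing (same q) → P p → P q → P (p ⊗ q)
    involution  : ∀ {p} → Pairing (same p) → P p → P (p *)
    composition : ∀ {p p′} (C : Composition p p′) → Pairing (same p) → Pairing (same p′) →
                  P p → P p′ → P (Composition.composite C)

pairing-empty : Pairing (same emptyP)
pairing-empty = record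
  { partner = id ; related-partner = same-refl emptyP ; related⇒partner = λ { (inj₁ ()) ; (inj₂ ()) } }

noSingletons-empty : NoSingletons (same emptyP)
noSingletons-empty (inj₁ ())
noSingletons-empty (inj₂ ())

oppositePairs-empty : OppositePairs (same emptyP) (ncol emptyP)
oppositePairs-empty (inj₁ ())
oppositePairs-empty (inj₂ ())

module _ (c : Color) where

  swapId : PtOf (idP c) → PtOf (idP c)
  swapId (inj₁ _) = inj₂ Fin.zero
  swapId (inj₂ _) = inj₁ Fin.zero

  pairing-id : Pairing (same (idP c))
  pairing-id = record { partner = swapId ; related-partner = λ _ → refl ; related⇒partner = only }
    where
    only : ∀ a y → same (idP c) a y ≡ true → y ≡ a ⊎ y ≡ swapId a
    only (inj₁ Fin.zero) (inj₁ Fin.zero) _ = inj₁ refl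
    only (inj₁ Fin.zero) (inj₂ Fin.zero) _ = inj₂ refl
    only (inj₂ Fin.zero) (inj₂ Fin.zero) _ = inj₁ refl
    only (inj₂ Fin.zero) (inj₁ Fin.zero) _ = inj₂ refl

  noSingletons-id : NoSingletons (same (idP c))
  noSingletons-id (inj₁ Fin.zero) = inj₂ Fin.zero , (λ ()) , refl
  noSingletons-id (inj₂ Fin.zero) = inj₁ Fin.zero , (λ ()) , refl

  oppositePairs-id : OppositePairs (same (idP c)) (ncol (idP c))
  oppositePairs-id (inj₁ Fin.zero) (inj₁ Fin.zero) b≢a _ = ⊥-elim (b≢a refl)
  oppositePairs-id (inj₁ Fin.zero) (inj₂ Fin.zero) _   _ = refl
  oppositePairs-id (inj₂ Fin.zero) (inj₁ Fin.zero) _   _ = sym (inv-involutive c)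
  oppositePairs-id (inj₂ Fin.zero) (inj₂ Fin.zero) b≢a _ = ⊥-elim (b≢a refl)

  swapPair : PtOf (pairP c (inv c)) → PtOf (pairP c (inv c))
  swapPair (inj₁ Fin.zero)            = inj₁ (Fin.suc Fin.zero)
  swapPair (inj₁ (Fin.suc Fin.zero))  = inj₁ Fin.zero

  pairing-pair : Pairing (same (pairP c (inv c)))
  pairing-pair = record { partner = swapPair ; related-partner = λ _ → refl ; related⇒partner = only }
    where
    only : ∀ a y → same (pairP c (inv c)) a y ≡ true → y ≡ a ⊎ y ≡ swapPair a
    only (inj₁ Fin.zero)           (inj₁ Fin.zero)           _ = inj₁ refl
    only (inj₁ Fin.zero)           (inj₁ (Fin.suc Fin.zero)) _ = inj₂ refl
    only (inj₁ (Fin.suc Fin.zero)) (inj₁ (Fin.suc Fin.zero)) _ = inj₁ refl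
    only (inj₁ (Fin.suc Fin.zero)) (inj₁ Fin.zero)           _ = inj₂ refl

  noSingletons-pair : NoSingletons (same (pairP c (inv c)))
  noSingletons-pair (inj₁ Fin.zero)           = inj₁ (Fin.suc Fin.zero) , (λ ()) , refl
  noSingletons-pair (inj₁ (Fin.suc Fin.zero)) = inj₁ Fin.zero , (λ ()) , refl

  oppositePairs-pair : OppositePairs (same (pairP c (inv c))) (ncol (pairP c (inv c)))
  oppositePairs-pair (inj₁ Fin.zero)           (inj₁ Fin.zero)           b≢a _ = ⊥-elim (b≢a refl)
  oppositePairs-pair (inj₁ Fin.zero)           (inj₁ (Fin.suc Fin.zero)) _   _ = refl
  oppositePairs-pair (inj₁ (Fin.suc Fin.zero)) (inj₁ Fin.zero)           _   _ = sym (inv-involutive c)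
  oppositePairs-pair (inj₁ (Fin.suc Fin.zero)) (inj₁ (Fin.suc Fin.zero)) b≢a _ = ⊥-elim (b≢a refl)

zeroTotal-id : ∀ c → ZeroTotal (idP c)
zeroTotal-id ○ = refl
zeroTotal-id ● = refl

zeroTotal-pair : ∀ c → ZeroTotal (pairP c (inv c))
zeroTotal-pair ○ = refl
zeroTotal-pair ● = refl

⊤-closed : ClosedUnderPairings (λ _ → ⊤)
⊤-closed = record
  { empty = tt ; identity = λ _ → tt ; pair = λ _ → tt
  ; tensor = λ _ _ _ _ → tt ; involution = λ _ _ → tt ; composition = λ _ _ _ _ _ → tt }

×-closed : ∀ {P Q} → ClosedUnderPairings P → ClosedUnderPairings Q → ClosedUnderPairings (λ p → P p × Q p)
×-closed cP cQ = record
  { empty = P.empty , Q.empty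
  ; identity = λ c → P.identity c , Q.identity c
  ; pair = λ c → P.pair c , Q.pair c
  ; tensor = λ Pp Pq (xp , yp) (xq , yq) → P.tensor Pp Pq xp xq , Q.tensor Pp Pq yp yq
  ; involution = λ Pp (xp , yp) → P.involution Pp xp , Q.involution Pp yp
  ; composition = λ C Pp Pp′ (xp , yp) (xp′ , yp′) → P.composition C Pp Pp′ xp xp′ , Q.composition C Pp Pp′ yp yp′
  }
  where
  module P = ClosedUnderPairings cP
  module Q = ClosedUnderPairings cQ

noSingletons-closed : ClosedUnderPairings (λ p → NoSingletons (same p))
noSingletons-closed = record
  { empty = noSingletons-empty ; identity = noSingletons-id ; pair = noSingletons-pair
  ; tensor = λ {p} {q} _ _ → noSingletons-⊗ p q
  ; involution = λ {p} _ → noSingletons-* p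
  ; composition = λ C Pp Pp′ → Glued.noSingletons-∘ C Pp Pp′ }

oppositePairs-closed : ClosedUnderPairings (λ p → OppositePairs (same p) (ncol p))
oppositePairs-closed = record
  { empty = oppositePairs-empty ; identity = oppositePairs-id ; pair = oppositePairs-pair
  ; tensor = λ {p} {q} _ _ → oppositePairs-⊗ p q
  ; involution = λ {p} _ → oppositePairs-* p
  ; composition = λ C Pp Pp′ → Glued.oppositePairs-∘ C Pp Pp′ }

zeroTotal-closed : ClosedUnderPairings ZeroTotal
zeroTotal-closed = record
  { empty = refl ; identity = zeroTotal-id ; pair = zeroTotal-pair
  ; tensor = λ {p} {q} _ _ Σp≡0 Σq≡0 → trans (Σ-⊗ p q) (cong₂ _+_ Σp≡0 Σq≡0)
  ; involution = λ {p} _ Σp≡0 → trans (Σ-* p) (cong -_ Σp≡0)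
  ; composition = λ C _ _ Σp≡0 Σp′≡0 → trans (Σ-composite C) (cong₂ _+_ Σp≡0 Σp′≡0) }

even-+ : ∀ x y → + 2 ∣ x → + 2 ∣ y → + 2 ∣ x + y
even-+ x y 2∣x 2∣y = Signed.∣⇒∣ᵤ {+ 2} {x + y}
  (Signed.∣m∣n⇒∣m+n (Signed.∣ᵤ⇒∣ {+ 2} {x} 2∣x) (Signed.∣ᵤ⇒∣ {+ 2} {y} 2∣y))

even-neg : ∀ x → + 2 ∣ x → + 2 ∣ - x
even-neg x 2∣x = Signed.∣⇒∣ᵤ {+ 2} { - x} (Signed.∣m⇒∣-m (Signed.∣ᵤ⇒∣ {+ 2} {x} 2∣x))

even-zero : ∀ {x} → x ≡ + 0 → + 2 ∣ x
even-zero refl = divides 0 refl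

evenTotal-closed : ClosedUnderPairings EvenTotal
evenTotal-closed = record
  { empty = even-zero refl ; identity = even-zero ∘ zeroTotal-id ; pair = even-zero ∘ zeroTotal-pair
  ; tensor = λ {p} {q} _ _ 2∣Σp 2∣Σq → subst (+ 2 ∣_) (sym (Σ-⊗ p q)) (even-+ (Σp p) (Σp q) 2∣Σp 2∣Σq)
  ; involution = λ {p} _ 2∣Σp → subst (+ 2 ∣_) (sym (Σ-* p)) (even-neg (Σp p) 2∣Σp)
  ; composition = λ {p} {p′} C _ _ 2∣Σp 2∣Σp′ →
      subst (+ 2 ∣_) (sym (Σ-composite C)) (even-+ (Σp p) (Σp p′) 2∣Σp 2∣Σp′) }

pairings-isCategory : ∀ {P} → ClosedUnderPairings P → IsCategory (λ p → Pairing (same p) × P p)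
pairings-isCategory closed = record
  { hasEmpty  = pairing-empty , empty
  ; hasId○    = pairing-id ○ , identity ○
  ; hasId●    = pairing-id ● , identity ●
  ; hasPair●○ = pairing-pair ● , pair ●
  ; hasPair○● = pairing-pair ○ , pair ○
  ; closed⊗   = λ p q (Pp , xp) (Pq , xq) → pairing-⊗ p q Pp Pq , tensor Pp Pq xp xq
  ; closed*   = λ p (Pp , xp) → pairing-* p Pp , involution Pp xp
  ; closedComp = λ p p′ rows colours rel rel-refl rel-sym rel-trans is-composite (Pp , xp) (Pp′ , xp′) →
      let C = record { rows = rows ; colours = colours ; rel = rel ; rel-refl = rel-refl ; rel-sym = rel-sym
                     ; rel-trans = rel-trans ; is-composite = is-composite }
      in Glued.pairing-∘ C Pp Pp′ , composition C Pp Pp′ xp xp′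
  }
  where open ClosedUnderPairings closed

isCategory-⇔ : ∀ {C D : Part → Set} → (∀ p → C p ⇔ D p) → IsCategory D → IsCategory C
isCategory-⇔ {C} {D} C⇔D isCat = record
  { hasEmpty = from hasEmpty ; hasId○ = from hasId○ ; hasId● = from hasId●
  ; hasPair●○ = from hasPair●○ ; hasPair○● = from hasPair○●
  ; closed⊗ = λ p q Cp Cq → from (closed⊗ p q (to Cp) (to Cq))
  ; closed* = λ p Cp → from (closed* p (to Cp))
  ; closedComp = λ p p′ e ce s sr ss st iscr Cp Cp′ → from (closedComp p p′ e ce s sr ss st iscr (to Cp) (to Cp′))
  }
  where
  open IsCategory isCat
  from : ∀ {p} → D p → C p
  from {p} = Equivalence.from (C⇔D p)
  to : ∀ {p} → C p → D p
  to {p} = Equivalence.to (C⇔D p)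

lemma6p10 : IsCategory (R Qa) × IsCategory (R Qb) × IsCategory (R Qc) × IsCategory (R Qd)
lemma6p10 =
  isCategory-⇔ R-Qa⇔ (pairings-isCategory ⊤-closed) ,
  isCategory-⇔ R-Qb⇔ (pairings-isCategory (×-closed noSingletons-closed evenTotal-closed)) ,
  isCategory-⇔ R-Qc⇔
    (pairings-isCategory (×-closed noSingletons-closed (×-closed oppositePairs-closed zeroTotal-closed))) ,
  isCategory-⇔ R-Qd⇔ (pairings-isCategory oppositePairs-closed)
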